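{- Let $G$ be a simple undirected graph on $n$ vertices accessible through its independent set oracle. Let $k\ge3$ and let $A_1,\dots,A_k$ be pairwise disjoint vertex sets, each of which is an independent set of $G$, such that for every $1\le i<j\le k-1$ the set $A_i\cup A_j$ is not an independent set of $G$. Then there exists a deterministic algorithm that enumerates all edges of the subgraph of $G$ induced on $\bigcup_{i=1}^k A_i$, such that for every $t$ the $t$-th edge is reported after $O(t\log n)$ independent set queries, and the algorithm terminates after $O(X\log n)$ independent set queries, where $X$ is the total number of edges of the subgraph induced on $\bigcup_{i=1}^k A_i$.
   Context: Independent set oracle: given a vertex set $U$, it returns $1$ if no edge of $G$ has both endpoints in $U$, and $0$ otherwise. The constants in $O(\cdot)$ are absolute. -}

module Defs where

open import Data.Nat using (ℕ; zero; suc; _+_; _*_; _≤_; _<_)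
open import Data.Bool using (Bool; true; false; _∧_; if_then_else_)
open import Data.Fin using (Fin; toℕ)
open import Data.Fin.Subset using (Subset; _∈_; _∩_; _∪_; Empty; ⋃)
open import Data.List using (List; []; _∷_; length; lookup; map; allFin; cartesianProduct)
open import Data.Nat.ListAction using (sum)
open import Data.Product using (Σ; _×_; _,_; proj₁; proj₂)
open import Data.Sum using (_⊎_)
open import Data.Vec using (Vec)
import Data.Vec as V
open import Relation.Binary.PropositionalEquality using (_≡_)
open import Relation.Nullary using (¬_)
open import Function.Bundles using (_⇔_)

record Graph (n : ℕ) : Set where
  field
    adj    : Fin n → Fin n → Bool
    sym    : ∀ u v → adj u v ≡ adj v u
    irrefl : ∀ u → adj u u ≡ false
open Graph public

IsIndependent : ∀ {n} → Graph n → Subset n → Set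
IsIndependent G U = ∀ u v → u ∈ U → v ∈ U → adj G u v ≡ false

IsIndepOracle : ∀ {n} → Graph n → (Subset n → Bool) → Set
IsIndepOracle G O = ∀ U → (O U ≡ true) ⇔ IsIndependent G U

-- Deterministic (adaptive) query algorithms with streaming output:
-- finite decision trees that may ask an independent set query (branching
-- on the answer), report an edge, or halt.
data Alg (n : ℕ) : Set where
  done   : Alg n
  query  : Subset n → (Bool → Alg n) → Alg n
  report : Fin n → Fin n → Alg n → Alg n

-- Returns the list of reported edges, each tagged with the number
-- of queries made before it was reported, and the total number of queries.
runFrom : ∀ {n} → ℕ → Alg n → (Subset n → Bool) → List (Fin n × Fin n × ℕ) × ℕ
runFrom q done         O = [] , q
runFrom q (query U k)  O = runFrom (suc q) (k (O U)) O
runFrom q (report u v a) O with runFrom q a O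
... | es , tot = ((u , v , q) ∷ es) , tot

run : ∀ {n} → Alg n → (Subset n → Bool) → List (Fin n × Fin n × ℕ) × ℕ
run = runFrom 0

InducedEdge : ∀ {n} → Graph n → Subset n → Fin n → Fin n → Set
InducedEdge G S u v = u ∈ S × v ∈ S × adj G u v ≡ true

SamePair : ∀ {n} → Fin n × Fin n → Fin n × Fin n → Set
SamePair (u , v) (u' , v') = (u ≡ u' × v ≡ v') ⊎ (u ≡ v' × v ≡ u')

edgeOf : ∀ {n} → Fin n × Fin n × ℕ → Fin n × Fin n
edgeOf (u , v , _) = u , v

timeOf : ∀ {n} → Fin n × Fin n × ℕ → ℕ
timeOf (_ , _ , q) = q

Enumerates : ∀ {n} → Graph n → Subset n → List (Fin n × Fin n × ℕ) → Set
Enumerates G S es =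
  (∀ i → InducedEdge G S (proj₁ (edgeOf (lookup es i))) (proj₂ (edgeOf (lookup es i))))
  × (∀ u v → InducedEdge G S u v → Σ (Fin (length es)) λ i → SamePair (u , v) (edgeOf (lookup es i)))
  × (∀ i j → SamePair (edgeOf (lookup es i)) (edgeOf (lookup es j)) → i ≡ j)

edgeCount : ∀ {n} → Graph n → Subset n → ℕ
edgeCount {n} G S = sum (map f (cartesianProduct (allFin n) (allFin n)))
  where
  f : Fin n × Fin n → ℕ
  f (u , v) = if (toℕ u Data.Nat.<ᵇ toℕ v) ∧ V.lookup S u ∧ V.lookup S v ∧ adj G u v then 1 else 0

bigUnion : ∀ {n k} → (Fin k → Subset n) → Subset n
bigUnion {k = k} A = ⋃ (map A (allFin k))

PairwiseDisjoint : ∀ {n k} → (Fin k → Subset n) → Set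
PairwiseDisjoint A = ∀ i j → ¬ i ≡ j → Empty (A i ∩ A j)

{-# OPTIONS --safe #-}
-- The edges between two independent blocks P = A i and Q = A j (i < j) are found by a quadtree
-- search. A box is a pair of index windows I, J of width 2^m; as P and Q are independent, the single
-- query on (P ∩ I) ∪ (Q ∩ J) tells whether some edge joins P ∩ I to Q ∩ J. If so, the box is split
-- into four boxes of width 2^(m-1), down to single pairs, which are reported. An explored box contains
-- an edge, so the four queries it spends on its sub-boxes can be charged to its first edge; by
-- induction on m, a search of depth m spends, besides its first query, at most 4m queries per
-- reported edge, also on every prefix of its output.
-- In a sequence of such searches in which all but possibly the last find an edge, each nonempty
-- search also pays for its own first query. By hypothesis every pair i < j < k - 1 has an edge, so
-- this applies to each row (i fixed, j = i + 1, …, k - 1), then to the sequence of rows, of which only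
-- the last can be empty, and the one remaining query is paid by the first edge. This gives
-- 4⌈log₂ n⌉ + 3 queries per edge, at most 7⌈log₂ n⌉ since some edge exists and hence n ≥ 2.

module Submission where

open import Defs hiding (sym)

open import Data.Bool using (Bool; true; false; if_then_else_; T; _∧_)
import Data.Bool as Bool
open import Data.Bool.Properties using (T-≡; not-¬; ¬-not)
open import Data.Empty using (⊥-elim)
open import Data.Fin using (Fin; toℕ; fromℕ<)
import Data.Fin as Fin
open import Data.Fin.Properties using (toℕ-fromℕ<; fromℕ<-toℕ; toℕ-injective; toℕ<n)
open import Data.Fin.Subset using (Subset; ⋃; _∩_; _∪_; ⊥; _⊆_) renaming (_∈_ to _∈ₛ_)
import Data.Fin.Subset.Properties as Subsetₚ
open import Data.List using (List; []; _∷_; _++_; map; length; lookup; filter; allFin; cartesianProduct)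
open import Data.List.Membership.Propositional using (_∈_)
open import Data.List.Membership.Propositional.Properties
  using (∈-++⁺ˡ; ∈-++⁺ʳ; ∈-++⁻; ∈-map⁺; ∈-map⁻; ∈-∃++; ∈-lookup; ∈-filter⁺; ∈-filter⁻; ∈-allFin;
         ∈-cartesianProduct⁺)
open import Data.List.Properties using (length-map; map-++; length-++)
open import Data.List.Relation.Binary.Disjoint.Propositional using (Disjoint)
import Data.List.Relation.Unary.All as All
open All using (All)
import Data.List.Relation.Unary.AllPairs as AllPairs
open AllPairs using (AllPairs; []; _∷_)
import Data.List.Relation.Unary.AllPairs.Properties as AllPairsₚ
import Data.List.Relation.Unary.Any as Any
open Any using (here; there)
import Data.List.Relation.Unary.Any.Properties as Anyₚ
open import Data.List.Relation.Unary.Unique.Propositional using (Unique)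
import Data.List.Relation.Unary.Unique.Propositional.Properties as Uniqueₚ
open import Data.Nat
  using (ℕ; zero; suc; _+_; _*_; _∸_; _^_; _≤_; _<_; z≤n; s≤s; z<s; _≟_; _≤?_; _<?_; _<ᵇ_; ⌊_/2⌋; ⌈_/2⌉)
open import Data.Nat.Induction using (<-wellFounded)
open import Data.Nat.ListAction using (sum)
open import Data.Nat.ListAction.Properties using (sum-++)
open import Data.Nat.Logarithm using (⌈log₂_⌉; ⌈log₂⌉-mono-≤)
open import Data.Nat.Logarithm.Core using (⌈log2⌉)
open import Data.Nat.Properties
open import Data.Nat.Tactic.RingSolver using (solve-∀)
open import Data.Product using (Σ; _×_; _,_; proj₁; proj₂)
open import Data.Sum using (_⊎_; inj₁; inj₂)
open import Data.Unit using (⊤; tt)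
import Data.Vec as V
import Data.Vec.Properties as V
open import Function.Bundles using (Equivalence)
open import Induction.WellFounded using (Acc; acc)
open import Relation.Binary.Definitions using (tri<; tri≈; tri>)
open import Relation.Binary.PropositionalEquality
open import Relation.Nullary using (¬_; Dec; yes; no; does)
open import Relation.Nullary.Decidable using (⌊_⌋; _×-dec_; toWitness; fromWitness)
open import Relation.Unary using (Decidable)

module _ {A : Set} where

  ∈⇒≢[] : ∀ {x : A} {xs} → x ∈ xs → xs ≢ []
  ∈⇒≢[] (here _)  ()
  ∈⇒≢[] (there _) ()

  ∉[] : ∀ {x : A} → ¬ x ∈ []
  ∉[] ()

  ≢[]⇒∈ : ∀ {xs : List A} → xs ≢ [] → Σ A λ x → x ∈ xs
  ≢[]⇒∈ {[]}    nonempty = ⊥-elim (nonempty refl)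
  ≢[]⇒∈ {x ∷ _} _        = x , here refl

  ∉⇒≡[] : ∀ (xs : List A) → (∀ {x} → ¬ x ∈ xs) → xs ≡ []
  ∉⇒≡[] []      _     = refl
  ∉⇒≡[] (x ∷ _) empty = ⊥-elim (empty (here refl))

  filter-[x]≢[]⇒≡[x] : ∀ {P : A → Set} (P? : Decidable P) x →
                       filter P? (x ∷ []) ≢ [] → filter P? (x ∷ []) ≡ x ∷ []
  filter-[x]≢[]⇒≡[x] P? x nonempty with does (P? x)
  ... | true  = refl
  ... | false = ⊥-elim (nonempty refl)

  lookup-injective : ∀ {R : A → A → Set} → (∀ {x y} → R x y → R y x) →
                     ∀ xs → AllPairs (λ x y → ¬ R x y) xs →
                     ∀ i j → R (lookup xs i) (lookup xs j) → i ≡ j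
  lookup-injective sym-R (x ∷ xs) _           Fin.zero    Fin.zero    _   = refl
  lookup-injective sym-R (x ∷ xs) (x≁ ∷ _)    Fin.zero    (Fin.suc j) rel = ⊥-elim (All.lookup x≁ (∈-lookup j) rel)
  lookup-injective sym-R (x ∷ xs) (x≁ ∷ _)    (Fin.suc i) Fin.zero    rel =
    ⊥-elim (All.lookup x≁ (∈-lookup i) (sym-R rel))
  lookup-injective sym-R (x ∷ xs) (_ ∷ apart) (Fin.suc i) (Fin.suc j) rel =
    cong Fin.suc (lookup-injective sym-R xs apart i j rel)

  unique⇒AllPairs¬ : ∀ {R : A → A → Set} {xs} → Unique xs →
                     (∀ {x y} → x ∈ xs → y ∈ xs → R x y → x ≡ y) → AllPairs (λ x y → ¬ R x y) xs
  unique⇒AllPairs¬ []            _        = []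
  unique⇒AllPairs¬ (x∉xs ∷ uniq) collapse =
    All.tabulate (λ y∈xs rel → All.lookup x∉xs y∈xs (collapse (here refl) (there y∈xs) rel)) ∷
    unique⇒AllPairs¬ uniq (λ x∈ y∈ → collapse (there x∈) (there y∈))

  ∈-map⇒lookup : ∀ {B : Set} (f : A → B) xs {y} → y ∈ map f xs →
                 Σ (Fin (length xs)) λ i → f (lookup xs i) ≡ y
  ∈-map⇒lookup f xs y∈ = Any.index (Anyₚ.map⁻ y∈) , sym (Anyₚ.lookup-index (Anyₚ.map⁻ y∈))

  length≤sum-map : ∀ (g : A → ℕ) xs ys → Unique xs → (∀ {x} → x ∈ xs → x ∈ ys × g x ≡ 1) →
                   length xs ≤ sum (map g ys)
  length≤sum-map g []       ys _            _       = z≤n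
  length≤sum-map g (x ∷ xs) ys (x∉xs ∷ uniq) counted with ∈-∃++ (proj₁ (counted (here refl)))
  ... | ys₁ , ys₂ , refl = begin
    suc (length xs)                           ≤⟨ s≤s (length≤sum-map g xs (ys₁ ++ ys₂) uniq counted′) ⟩
    suc (sum (map g (ys₁ ++ ys₂)))            ≡⟨ cong suc (sum-map-++ ys₁ ys₂) ⟩
    1 + (sum (map g ys₁) + sum (map g ys₂))   ≡⟨ regroup (sum (map g ys₁)) (sum (map g ys₂)) ⟩
    sum (map g ys₁) + (1 + sum (map g ys₂))   ≡⟨ cong (λ w → sum (map g ys₁) + (w + sum (map g ys₂))) (sym gx≡1) ⟩
    sum (map g ys₁) + sum (map g (x ∷ ys₂))   ≡⟨ sym (sum-map-++ ys₁ (x ∷ ys₂)) ⟩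
    sum (map g (ys₁ ++ x ∷ ys₂))              ∎
    where
    open ≤-Reasoning
    gx≡1 : g x ≡ 1
    gx≡1 = proj₂ (counted (here refl))
    regroup : ∀ a b → 1 + (a + b) ≡ a + (1 + b)
    regroup = solve-∀
    sum-map-++ : ∀ zs₁ zs₂ → sum (map g (zs₁ ++ zs₂)) ≡ sum (map g zs₁) + sum (map g zs₂)
    sum-map-++ zs₁ zs₂ = trans (cong sum (map-++ g zs₁ zs₂)) (sum-++ (map g zs₁) (map g zs₂))
    counted′ : ∀ {y} → y ∈ xs → y ∈ ys₁ ++ ys₂ × g y ≡ 1
    counted′ {y} y∈xs with counted (there y∈xs)
    ... | y∈ys , gy≡1 with ∈-++⁻ ys₁ y∈ys
    ...   | inj₁ y∈ys₁           = ∈-++⁺ˡ y∈ys₁ , gy≡1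
    ...   | inj₂ (here y≡x)      = ⊥-elim (All.lookup x∉xs y∈xs (sym y≡x))
    ...   | inj₂ (there y∈ys₂)   = ∈-++⁺ʳ ys₁ y∈ys₂ , gy≡1

  concatFrom : (ℕ → List A) → ℕ → ℕ → List A
  concatFrom g a zero    = []
  concatFrom g a (suc m) = g a ++ concatFrom g (suc a) m

  ∈-concatFrom⁻ : ∀ g a m {x} → x ∈ concatFrom g a m → Σ ℕ λ i → a ≤ i × i < a + m × x ∈ g i
  ∈-concatFrom⁻ g a (suc m) x∈ with ∈-++⁻ (g a) x∈
  ... | inj₁ x∈ga   = a , ≤-refl , m<m+n a z<s , x∈ga
  ... | inj₂ x∈rest with ∈-concatFrom⁻ g (suc a) m x∈rest
  ...   | i , a<i , i<a+1+m , x∈gi = i , <⇒≤ a<i , subst (i <_) (sym (+-suc a m)) i<a+1+m , x∈gi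

  ∈-concatFrom⁺ : ∀ g a m {i x} → a ≤ i → i < a + m → x ∈ g i → x ∈ concatFrom g a m
  ∈-concatFrom⁺ g a zero    a≤i i<a+0 _ = ⊥-elim (<⇒≱ i<a+0 (≤-trans (≤-reflexive (+-identityʳ a)) a≤i))
  ∈-concatFrom⁺ g a (suc m) {i} a≤i i<a+1+m x∈gi with a ≟ i
  ... | yes refl = ∈-++⁺ˡ x∈gi
  ... | no a≢i   =
    ∈-++⁺ʳ (g a) (∈-concatFrom⁺ g (suc a) m (≤∧≢⇒< a≤i a≢i) (subst (i <_) (+-suc a m) i<a+1+m) x∈gi)

  concatFrom-≢[] : ∀ g a m {i} → a ≤ i → i < a + m → g i ≢ [] → concatFrom g a m ≢ []
  concatFrom-≢[] g a m a≤i i<a+m nonempty =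
    let x , x∈gi = ≢[]⇒∈ nonempty in ∈⇒≢[] (∈-concatFrom⁺ g a m a≤i i<a+m x∈gi)

  concatFrom-unique : ∀ g a m → (∀ i → Unique (g i)) → (∀ {i j x} → x ∈ g i → x ∈ g j → i ≡ j) →
                      Unique (concatFrom g a m)
  concatFrom-unique g a zero    _      _        = []
  concatFrom-unique g a (suc m) unique disjoint =
    Uniqueₚ.++⁺ (unique a) (concatFrom-unique g (suc a) m unique disjoint) separated
    where
    separated : Disjoint (g a) (concatFrom g (suc a) m)
    separated (x∈ga , x∈rest) with ∈-concatFrom⁻ g (suc a) m x∈rest
    ... | i , a<i , _ , x∈gi = <-irrefl (disjoint x∈ga x∈gi) a<i

  disjoint-++⁺ʳ : ∀ {xs ys zs : List A} → Disjoint xs ys → Disjoint xs zs → Disjoint xs (ys ++ zs)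
  disjoint-++⁺ʳ {ys = ys} xs#ys xs#zs (v∈xs , v∈ys++zs) with ∈-++⁻ ys v∈ys++zs
  ... | inj₁ v∈ys = xs#ys (v∈xs , v∈ys)
  ... | inj₂ v∈zs = xs#zs (v∈xs , v∈zs)

infix 4 _∈[_⋯_⟩ _∈[_⋯_⟩?

_∈[_⋯_⟩ : ℕ → ℕ → ℕ → Set
x ∈[ a ⋯ b ⟩ = a ≤ x × x < b

_∈[_⋯_⟩? : ∀ x a b → Dec (x ∈[ a ⋯ b ⟩)
x ∈[ a ⋯ b ⟩? = (a ≤? x) ×-dec (x <? b)

∈[⋯⟩-split : ∀ {x a c} b → x ∈[ a ⋯ c ⟩ → x ∈[ a ⋯ b ⟩ ⊎ x ∈[ b ⋯ c ⟩
∈[⋯⟩-split {x} b (a≤x , x<c) with x <? b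
... | yes x<b = inj₁ (a≤x , x<b)
... | no  x≮b = inj₂ (≮⇒≥ x≮b , x<c)

∈[⋯⟩-weakenʳ : ∀ {x a b c} → b ≤ c → x ∈[ a ⋯ b ⟩ → x ∈[ a ⋯ c ⟩
∈[⋯⟩-weakenʳ b≤c (a≤x , x<b) = a≤x , <-≤-trans x<b b≤c

∈[⋯⟩-weakenˡ : ∀ {x a b c} → a ≤ b → x ∈[ b ⋯ c ⟩ → x ∈[ a ⋯ c ⟩
∈[⋯⟩-weakenˡ a≤b (b≤x , x<c) = ≤-trans a≤b b≤x , x<c

∈[⋯+1⟩⇒≡ : ∀ {x a} → x ∈[ a ⋯ a + 1 ⟩ → x ≡ a
∈[⋯+1⟩⇒≡ {x} {a} (a≤x , x<a+1) = ≤-antisym (≤-pred (subst (x <_) (+-comm a 1) x<a+1)) a≤x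

n≤2^⌈log₂n⌉ : ∀ n → n ≤ 2 ^ ⌈log₂ n ⌉
n≤2^⌈log₂n⌉ n = n≤2^⌈log2⌉ n (<-wellFounded n)
  where
  n≤2^⌈log2⌉ : ∀ n (rec : Acc _<_ n) → n ≤ 2 ^ ⌈log2⌉ n rec
  n≤2^⌈log2⌉ 0             _         = z≤n
  n≤2^⌈log2⌉ 1             _         = s≤s z≤n
  n≤2^⌈log2⌉ (suc (suc n)) (acc rec) = begin
    2 + n                                     ≤⟨ +-monoʳ-≤ 2 n≤⌈n/2⌉+⌈n/2⌉ ⟩
    2 + (⌈ n /2⌉ + ⌈ n /2⌉)                   ≡⟨ regroup ⌈ n /2⌉ ⟩
    2 * suc ⌈ n /2⌉                           ≤⟨ *-monoʳ-≤ 2 (n≤2^⌈log2⌉ (suc ⌈ n /2⌉) _) ⟩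
    2 * 2 ^ ⌈log2⌉ (suc ⌈ n /2⌉) _            ∎
    where
    open ≤-Reasoning
    regroup : ∀ h → 2 + (h + h) ≡ 2 * suc h
    regroup = solve-∀
    n≤⌈n/2⌉+⌈n/2⌉ : n ≤ ⌈ n /2⌉ + ⌈ n /2⌉
    n≤⌈n/2⌉+⌈n/2⌉ = begin
      n                     ≡⟨ sym (⌊n/2⌋+⌈n/2⌉≡n n) ⟩
      ⌊ n /2⌋ + ⌈ n /2⌉     ≤⟨ +-monoˡ-≤ ⌈ n /2⌉ (⌊n/2⌋≤⌈n/2⌉ n) ⟩
      ⌈ n /2⌉ + ⌈ n /2⌉     ∎

a+2^m+2^m≡a+2^[1+m] : ∀ a m → a + 2 ^ m + 2 ^ m ≡ a + 2 ^ suc m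
a+2^m+2^m≡a+2^[1+m] a m = regroup a (2 ^ m)
  where
  regroup : ∀ a x → a + x + x ≡ a + 2 * x
  regroup = solve-∀

m*[3+d*4]≤7*[m*d] : ∀ {d} → 1 ≤ d → ∀ m → m * (3 + d * 4) ≤ 7 * (m * d)
m*[3+d*4]≤7*[m*d] {d} 1≤d m = begin
  m * (3 + d * 4)        ≤⟨ *-monoʳ-≤ m (+-monoˡ-≤ (d * 4) (*-monoʳ-≤ 3 1≤d)) ⟩
  m * (3 * d + d * 4)    ≡⟨ regroup m d ⟩
  7 * (m * d)            ∎
  where
  open ≤-Reasoning
  regroup : ∀ m d → m * (3 * d + d * 4) ≡ 7 * (m * d)
  regroup = solve-∀

module _ {n : ℕ} where

  select : {P : Fin n → Set} → Decidable P → Subset n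
  select P? = V.tabulate (λ u → ⌊ P? u ⌋)

  ∈-select⁺ : ∀ {P : Fin n → Set} (P? : Decidable P) {u} → P u → u ∈ₛ select P?
  ∈-select⁺ P? {u} Pu = V.lookup⇒[]= u _ (trans (V.lookup∘tabulate _ u) (Equivalence.to T-≡ (fromWitness Pu)))

  ∈-select⁻ : ∀ {P : Fin n → Set} (P? : Decidable P) {u} → u ∈ₛ select P? → P u
  ∈-select⁻ P? {u} u∈ = toWitness (Equivalence.from T-≡ (trans (sym (V.lookup∘tabulate _ u)) (V.[]=⇒lookup u∈)))

  interval : ℕ → ℕ → Subset n
  interval a b = select (λ u → toℕ u ∈[ a ⋯ b ⟩?)

  ∈-⋃⁺ : ∀ {u : Fin n} {S} Ss → S ∈ Ss → u ∈ₛ S → u ∈ₛ ⋃ Ss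
  ∈-⋃⁺ (S ∷ Ss) (here refl)  u∈S = Subsetₚ.p⊆p∪q (⋃ Ss) u∈S
  ∈-⋃⁺ (S ∷ Ss) (there S∈Ss) u∈S = Subsetₚ.q⊆p∪q S (⋃ Ss) (∈-⋃⁺ Ss S∈Ss u∈S)

  ∈-⋃⁻ : ∀ {u : Fin n} Ss → u ∈ₛ ⋃ Ss → Σ (Subset n) λ S → S ∈ Ss × u ∈ₛ S
  ∈-⋃⁻ []       u∈ = ⊥-elim (Subsetₚ.∉⊥ u∈)
  ∈-⋃⁻ (S ∷ Ss) u∈ with Subsetₚ.x∈p∪q⁻ S (⋃ Ss) u∈
  ... | inj₁ u∈S  = S , here refl , u∈S
  ... | inj₂ u∈Ss = let S′ , S′∈Ss , u∈S′ = ∈-⋃⁻ Ss u∈Ss in S′ , there S′∈Ss , u∈S′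

  ∈-bigUnion⁺ : ∀ {k} (A : Fin k → Subset n) i {u} → u ∈ₛ A i → u ∈ₛ bigUnion A
  ∈-bigUnion⁺ A i = ∈-⋃⁺ (map A (allFin _)) (∈-map⁺ A (∈-allFin i))

  ∈-bigUnion⁻ : ∀ {k} (A : Fin k → Subset n) {u} → u ∈ₛ bigUnion A → Σ (Fin k) λ i → u ∈ₛ A i
  ∈-bigUnion⁻ A u∈ with ∈-⋃⁻ (map A (allFin _)) u∈
  ... | S , S∈ , u∈S with ∈-map⁻ A S∈
  ...   | i , _ , refl = i , u∈S

≢⇒2≤n : ∀ {n} {u v : Fin n} → u ≢ v → 2 ≤ n
≢⇒2≤n {suc zero}    {Fin.zero} {Fin.zero} u≢v = ⊥-elim (u≢v refl)
≢⇒2≤n {suc (suc n)} _                         = s≤s (s≤s z≤n)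

indicator≡1 : ∀ {b₁ b₂ b₃ b₄} → T b₁ → b₂ ≡ true → b₃ ≡ true → b₄ ≡ true →
              (if b₁ ∧ b₂ ∧ b₃ ∧ b₄ then 1 else 0) ≡ 1
indicator≡1 {true} _ refl refl refl = refl

module _ {n : ℕ} where

  IsIndependent-⊆ : ∀ (G : Graph n) {U W} → U ⊆ W → IsIndependent G W → IsIndependent G U
  IsIndependent-⊆ G U⊆W independent u v u∈ v∈ = independent u v (U⊆W u∈) (U⊆W v∈)

  SamePair-sym : ∀ {x y : Fin n × Fin n} → SamePair x y → SamePair y x
  SamePair-sym (inj₁ (e₁ , e₂)) = inj₁ (sym e₁ , sym e₂)
  SamePair-sym (inj₂ (e₁ , e₂)) = inj₂ (sym e₂ , sym e₁)

  InducedEdge-sym : ∀ {G : Graph n} {S u v} → InducedEdge G S u v → InducedEdge G S v u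
  InducedEdge-sym {G} {u = u} {v} (u∈ , v∈ , uv) = v∈ , u∈ , trans (Graph.sym G v u) uv

  InducedEdge⇒≢ : ∀ {G : Graph n} {S u v} → InducedEdge G S u v → u ≢ v
  InducedEdge⇒≢ {G} {u = u} (_ , _ , uv) refl = not-¬ uv (irrefl G u)

  orient : Fin n × Fin n → Fin n × Fin n
  orient (u , v) with toℕ u <? toℕ v
  ... | yes _ = u , v
  ... | no  _ = v , u

  orient-injective : ∀ x y → orient x ≡ orient y → SamePair x y
  orient-injective (u , v) (u′ , v′) eq with toℕ u <? toℕ v | toℕ u′ <? toℕ v′
  ... | yes _ | yes _ = inj₁ (cong proj₁ eq , cong proj₂ eq)
  ... | yes _ | no  _ = inj₂ (cong proj₁ eq , cong proj₂ eq)
  ... | no  _ | yes _ = inj₂ (cong proj₂ eq , cong proj₁ eq)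
  ... | no  _ | no  _ = inj₁ (cong proj₂ eq , cong proj₁ eq)

  orient-InducedEdge : ∀ {G : Graph n} {S u v} → InducedEdge G S u v →
                       let (u′ , v′) = orient (u , v) in toℕ u′ < toℕ v′ × InducedEdge G S u′ v′
  orient-InducedEdge {G} {u = u} {v} e with toℕ u <? toℕ v
  ... | yes u<v = u<v , e
  ... | no  u≮v =
    ≤∧≢⇒< (≮⇒≥ u≮v) (λ v≡u → InducedEdge⇒≢ {G} e (toℕ-injective (sym v≡u))) , InducedEdge-sym {G} e

  length≤edgeCount : ∀ (G : Graph n) S (L : List (Fin n × Fin n)) →
                     (∀ {x} → x ∈ L → InducedEdge G S (proj₁ x) (proj₂ x)) →
                     AllPairs (λ x y → ¬ SamePair x y) L → length L ≤ edgeCount G S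
  length≤edgeCount G S L induced distinct = begin
    length L               ≡⟨ sym (length-map orient L) ⟩
    length (map orient L)  ≤⟨ length≤sum-map _ (map orient L) allPairs oriented-unique counted ⟩
    edgeCount G S          ∎
    where
    open ≤-Reasoning
    allPairs : List (Fin n × Fin n)
    allPairs = cartesianProduct (allFin n) (allFin n)
    oriented-unique : Unique (map orient L)
    oriented-unique = AllPairsₚ.map⁺ (AllPairs.map (λ ¬same eq → ¬same (orient-injective _ _ eq)) distinct)
    -- The second component is the summand in the definition of edgeCount.
    counted : ∀ {y} → y ∈ map orient L → y ∈ allPairs ×
              (if (toℕ (proj₁ y) <ᵇ toℕ (proj₂ y)) ∧ V.lookup S (proj₁ y) ∧ V.lookup S (proj₂ y)
                  ∧ adj G (proj₁ y) (proj₂ y) then 1 else 0) ≡ 1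
    counted y∈ with ∈-map⁻ orient y∈
    ... | x , x∈L , refl =
      let u<v , u∈S , v∈S , uv = orient-InducedEdge {G} (induced x∈L) in
      ∈-cartesianProduct⁺ (∈-allFin _) (∈-allFin _) ,
      indicator≡1 (<⇒<ᵇ u<v) (V.[]=⇒lookup u∈S) (V.[]=⇒lookup v∈S) uv

  enumerates : ∀ (G : Graph n) S (es : List (Fin n × Fin n × ℕ)) L → map edgeOf es ≡ L →
               (∀ {x} → x ∈ L → InducedEdge G S (proj₁ x) (proj₂ x)) →
               (∀ {u v} → InducedEdge G S u v → (u , v) ∈ L ⊎ (v , u) ∈ L) →
               AllPairs (λ x y → ¬ SamePair x y) L →
               Enumerates G S es
  enumerates G S es _ refl sound complete distinct =
    (λ t → sound (∈-map⁺ edgeOf (∈-lookup t))) ,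
    found ,
    lookup-injective SamePair-sym es (AllPairsₚ.map⁻ distinct)
    where
    found : ∀ u v → InducedEdge G S u v → Σ (Fin (length es)) λ t → SamePair (u , v) (edgeOf (lookup es t))
    found u v e with complete e
    ... | inj₁ uv∈ = let t , eq = ∈-map⇒lookup edgeOf es uv∈ in
                     t , inj₁ (sym (cong proj₁ eq) , sym (cong proj₂ eq))
    ... | inj₂ vu∈ = let t , eq = ∈-map⇒lookup edgeOf es vu∈ in
                     t , inj₂ (sym (cong proj₂ eq) , sym (cong proj₁ eq))

-- Query algorithms and their cost

module _ {n : ℕ} where

  infixr 5 _>>_
  _>>_ : Alg n → Alg n → Alg n
  done         >> b = b
  query U k    >> b = query U (λ x → k x >> b)
  report u v a >> b = report u v (a >> b)

  sequenceFrom : (ℕ → Alg n) → ℕ → ℕ → Alg n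
  sequenceFrom f a zero    = done
  sequenceFrom f a (suc m) = f a >> sequenceFrom f (suc a) m

  OnSchedule : ℕ → ℕ → List (Fin n × Fin n × ℕ) → Set
  OnSchedule B c []       = ⊤
  OnSchedule B c (e ∷ es) = timeOf e ≤ B + c × OnSchedule (B + c) c es

  OnSchedule-mono : ∀ {B B′ c c′} es → B ≤ B′ → c ≤ c′ → OnSchedule B c es → OnSchedule B′ c′ es
  OnSchedule-mono []       _    _    _          = tt
  OnSchedule-mono (e ∷ es) B≤B′ c≤c′ (e≤ , es≤) =
    ≤-trans e≤ (+-mono-≤ B≤B′ c≤c′) , OnSchedule-mono es (+-mono-≤ B≤B′ c≤c′) c≤c′ es≤

  OnSchedule-++ : ∀ {B c} es fs → OnSchedule B c es → OnSchedule (B + length es * c) c fs →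
                  OnSchedule B c (es ++ fs)
  OnSchedule-++ {B} {c} []       fs _          fs≤ = subst (λ B′ → OnSchedule B′ c fs) (+-identityʳ B) fs≤
  OnSchedule-++ {B} {c} (e ∷ es) fs (e≤ , es≤) fs≤ =
    e≤ , OnSchedule-++ es fs es≤ (subst (λ B′ → OnSchedule B′ c fs) (sym (+-assoc B c _)) fs≤)

  OnSchedule-absorb : ∀ {B c x} es → es ≢ [] → OnSchedule (x + B) c es → OnSchedule B (x + c) es
  OnSchedule-absorb []       nonempty _          = ⊥-elim (nonempty refl)
  OnSchedule-absorb {B} {c} {x} (e ∷ es) _ (e≤ , es≤) =
    subst (timeOf e ≤_) shift e≤ , OnSchedule-mono es (≤-reflexive shift) (m≤n+m c x) es≤
    where
    shift : x + B + c ≡ B + (x + c)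
    shift = trans (cong (_+ c) (+-comm x B)) (+-assoc B x c)

  OnSchedule-lookup : ∀ {B c} es → OnSchedule B c es → ∀ t → timeOf (lookup es t) ≤ B + suc (toℕ t) * c
  OnSchedule-lookup {B} {c} (e ∷ es) (e≤ , _)   Fin.zero    =
    subst (λ c′ → timeOf e ≤ B + c′) (sym (+-identityʳ c)) e≤
  OnSchedule-lookup {B} {c} (e ∷ es) (_ , es≤) (Fin.suc t) =
    subst (timeOf (lookup es t) ≤_) (+-assoc B c _) (OnSchedule-lookup es es≤ t)

module Execution {n : ℕ} (O : Subset n → Bool) where

  output : ℕ → Alg n → List (Fin n × Fin n × ℕ)
  output q a = proj₁ (runFrom q a O)

  endTime : ℕ → Alg n → ℕ
  endTime q a = proj₂ (runFrom q a O)

  runFrom-report : ∀ q u v a → runFrom q (report u v a) O ≡ ((u , v , q) ∷ output q a , endTime q a)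
  runFrom-report q u v a with runFrom q a O
  ... | _ = refl

  runFrom->> : ∀ q a b → runFrom q (a >> b) O ≡ (output q a ++ output (endTime q a) b , endTime (endTime q a) b)
  runFrom->> q done         b = refl
  runFrom->> q (query U k)  b = runFrom->> (suc q) (k (O U)) b
  runFrom->> q (report u v a) b
    rewrite runFrom-report q u v (a >> b) | runFrom-report q u v a =
    cong (λ r → (u , v , q) ∷ proj₁ r , proj₂ r) (runFrom->> q a b)

  output->> : ∀ q a b → output q (a >> b) ≡ output q a ++ output (endTime q a) b
  output->> q a b = cong proj₁ (runFrom->> q a b)

  endTime->> : ∀ q a b → endTime q (a >> b) ≡ endTime (endTime q a) b
  endTime->> q a b = cong proj₂ (runFrom->> q a b)

  record Streams (a : Alg n) (L : List (Fin n × Fin n)) (s c : ℕ) : Set where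
    field
      reports    : ∀ q → map edgeOf (output q a) ≡ L
      onSchedule : ∀ q → OnSchedule (s + q) c (output q a)
      haltsBy    : ∀ q → endTime q a ≤ s + q + length L * c

    length-output : ∀ q → length (output q a) ≡ length L
    length-output q = trans (sym (length-map edgeOf (output q a))) (cong length (reports q))

  open Streams

  streams-done : ∀ {s c} → Streams done [] s c
  streams-done {s} = record
    { reports    = λ _ → refl
    ; onSchedule = λ _ → tt
    ; haltsBy    = λ q → ≤-trans (m≤n+m q s) (m≤m+n (s + q) 0)
    }

  streams-weaken : ∀ {a L s s′ c c′} → s ≤ s′ → c ≤ c′ → Streams a L s c → Streams a L s′ c′
  streams-weaken {a} {L} s≤s′ c≤c′ h = record
    { reports    = reports h
    ; onSchedule = λ q → OnSchedule-mono (output q a) (+-monoˡ-≤ q s≤s′) c≤c′ (onSchedule h q)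
    ; haltsBy    = λ q → ≤-trans (haltsBy h q) (+-mono-≤ (+-monoˡ-≤ q s≤s′) (*-monoʳ-≤ (length L) c≤c′))
    }

  streams->> : ∀ {a b L₁ L₂ s₁ s₂ c} → Streams a L₁ s₁ c → Streams b L₂ s₂ c →
               Streams (a >> b) (L₁ ++ L₂) (s₁ + s₂) c
  streams->> {a} {b} {L₁} {L₂} {s₁} {s₂} {c} h₁ h₂ = record
    { reports    = reports-seq
    ; onSchedule = λ q → subst (OnSchedule (s₁ + s₂ + q) c) (sym (output->> q a b))
        (OnSchedule-++ (output q a) _
          (OnSchedule-mono (output q a) (+-monoˡ-≤ q (m≤m+n s₁ s₂)) ≤-refl (onSchedule h₁ q))
          (OnSchedule-mono (output (endTime q a) b) (second-start q) ≤-refl (onSchedule h₂ (endTime q a))))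
    ; haltsBy    = haltsBy-seq
    }
    where
    reports-seq : ∀ q → map edgeOf (output q (a >> b)) ≡ L₁ ++ L₂
    reports-seq q = begin
      map edgeOf (output q (a >> b))                                   ≡⟨ cong (map edgeOf) (output->> q a b) ⟩
      map edgeOf (output q a ++ output (endTime q a) b)                ≡⟨ map-++ edgeOf (output q a) _ ⟩
      map edgeOf (output q a) ++ map edgeOf (output (endTime q a) b)   ≡⟨ cong₂ _++_ (reports h₁ q) (reports h₂ (endTime q a)) ⟩
      L₁ ++ L₂                                                         ∎
      where open ≡-Reasoning

    second-start : ∀ q → s₂ + endTime q a ≤ s₁ + s₂ + q + length (output q a) * c
    second-start q = begin
      s₂ + endTime q a                   ≤⟨ +-monoʳ-≤ s₂ (haltsBy h₁ q) ⟩
      s₂ + (s₁ + q + length L₁ * c)      ≡⟨ regroup s₁ s₂ q (length L₁ * c) ⟩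
      s₁ + s₂ + q + length L₁ * c        ≡⟨ cong (λ l → s₁ + s₂ + q + l * c) (sym (length-output h₁ q)) ⟩
      s₁ + s₂ + q + length (output q a) * c ∎
      where
      open ≤-Reasoning
      regroup : ∀ s₁ s₂ q x → s₂ + (s₁ + q + x) ≡ s₁ + s₂ + q + x
      regroup = solve-∀

    haltsBy-seq : ∀ q → endTime q (a >> b) ≤ s₁ + s₂ + q + length (L₁ ++ L₂) * c
    haltsBy-seq q = begin
      endTime q (a >> b)                                ≡⟨ endTime->> q a b ⟩
      endTime (endTime q a) b                           ≤⟨ haltsBy h₂ (endTime q a) ⟩
      s₂ + endTime q a + length L₂ * c                  ≤⟨ +-monoˡ-≤ (length L₂ * c) (+-monoʳ-≤ s₂ (haltsBy h₁ q)) ⟩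
      s₂ + (s₁ + q + length L₁ * c) + length L₂ * c     ≡⟨ regroup s₁ s₂ q (length L₁) (length L₂) c ⟩
      s₁ + s₂ + q + (length L₁ + length L₂) * c         ≡⟨ cong (λ l → s₁ + s₂ + q + l * c) (sym (length-++ L₁)) ⟩
      s₁ + s₂ + q + length (L₁ ++ L₂) * c               ∎
      where
      open ≤-Reasoning
      regroup : ∀ s₁ s₂ q l₁ l₂ c → s₂ + (s₁ + q + l₁ * c) + l₂ * c ≡ s₁ + s₂ + q + (l₁ + l₂) * c
      regroup = solve-∀

  streams-absorb : ∀ {a L s c} x → L ≢ [] → Streams a L (x + s) c → Streams a L s (x + c)
  streams-absorb {a} {L} {s} {c} x nonempty h = record
    { reports    = reports h
    ; onSchedule = λ q → OnSchedule-absorb (output q a) (output-nonempty q)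
        (subst (λ B → OnSchedule B c (output q a)) (+-assoc x s q) (onSchedule h q))
    ; haltsBy    = λ q → ≤-trans (haltsBy h q) (overhead-absorbed L nonempty q)
    }
    where
    output-nonempty : ∀ q → output q a ≢ []
    output-nonempty q empty = nonempty (trans (sym (reports h q)) (cong (map edgeOf) empty))
    overhead-absorbed : ∀ L → L ≢ [] → ∀ q → x + s + q + length L * c ≤ s + q + length L * (x + c)
    overhead-absorbed []      nonempty _ = ⊥-elim (nonempty refl)
    overhead-absorbed (_ ∷ L) _        q = begin
      x + s + q + (c + length L * c)          ≡⟨ regroup x s q c (length L * c) ⟩
      s + q + (x + c + length L * c)          ≤⟨ +-monoʳ-≤ (s + q) (+-monoʳ-≤ (x + c) (*-monoʳ-≤ (length L) (m≤n+m c x))) ⟩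
      s + q + (x + c + length L * (x + c))    ∎
      where
      open ≤-Reasoning
      regroup : ∀ x s q c y → x + s + q + (c + y) ≡ s + q + (x + c + y)
      regroup = solve-∀

  streams-query : ∀ {U k L s c} → Streams (k (O U)) L s c → Streams (query U k) L (suc s) c
  streams-query {U} {k} {L} {s} {c} h = record
    { reports    = λ q → reports h (suc q)
    ; onSchedule = λ q → subst (λ B → OnSchedule B c (output (suc q) (k (O U)))) (+-suc s q) (onSchedule h (suc q))
    ; haltsBy    = λ q → subst (λ B → endTime (suc q) (k (O U)) ≤ B + length L * c) (+-suc s q) (haltsBy h (suc q))
    }

  streams-report : ∀ {a L s c} u v → Streams a L s c → Streams (report u v a) ((u , v) ∷ L) s c
  streams-report {a} {L} {s} {c} u v h = record
    { reports    = λ q → subst (λ r → map edgeOf (proj₁ r) ≡ (u , v) ∷ L) (sym (runFrom-report q u v a))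
                             (cong ((u , v) ∷_) (reports h q))
    ; onSchedule = λ q → subst (λ r → OnSchedule (s + q) c (proj₁ r)) (sym (runFrom-report q u v a))
                             (≤-trans (m≤n+m q s) (m≤m+n (s + q) c) ,
                              OnSchedule-mono (output q a) (m≤m+n (s + q) c) ≤-refl (onSchedule h q))
    ; haltsBy    = λ q → subst (λ r → proj₂ r ≤ s + q + (c + length L * c)) (sym (runFrom-report q u v a))
                             (≤-trans (haltsBy h q) (+-monoʳ-≤ (s + q) (m≤n+m (length L * c) c)))
    }

  streams-sequenceFrom : ∀ {f g c} a m →
    (∀ i → a ≤ i → i < a + m → Streams (f i) (g i) 1 c) →
    (∀ i → a ≤ i → suc i < a + m → g i ≢ []) →
    Streams (sequenceFrom f a m) (concatFrom g a m) 1 (1 + c)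
  streams-sequenceFrom a zero          _       _        = streams-done
  streams-sequenceFrom {c = c} a (suc zero) streams _ =
    streams->> (streams-weaken ≤-refl (m≤n+m c 1) (streams a ≤-refl (m<m+n a z<s))) streams-done
  streams-sequenceFrom a (suc (suc m)) streams nonempty =
    streams->> (streams-absorb 1 (nonempty a ≤-refl 1+a<end) (streams a ≤-refl a<end))
               (streams-sequenceFrom (suc a) (suc m)
                 (λ i a<i i<end → streams i (<⇒≤ a<i) (subst (i <_) end≡ i<end))
                 (λ i a<i 1+i<end → nonempty i (<⇒≤ a<i) (subst (suc i <_) end≡ 1+i<end)))
    where
    end≡ : suc a + suc m ≡ a + suc (suc m)
    end≡ = sym (+-suc a (suc m))
    a<end : a < a + suc (suc m)
    a<end = m<m+n a z<s
    1+a<end : suc a < a + suc (suc m)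
    1+a<end = subst (suc a <_) end≡ (s≤s (m<m+n a z<s))

-- Quadtree search between two independent sets

module _ {n : ℕ} where

  InWindow : ℕ → ℕ → Fin n → Set
  InWindow m a u = toℕ u ∈[ a ⋯ a + 2 ^ m ⟩

  InWindow-lower : ∀ m {a u} → InWindow m a u → InWindow (suc m) a u
  InWindow-lower m {a} = ∈[⋯⟩-weakenʳ (+-monoʳ-≤ a (m≤m+n (2 ^ m) _))

  InWindow-upper : ∀ m {a u} → InWindow m (a + 2 ^ m) u → InWindow (suc m) a u
  InWindow-upper m {a} {u} (lo , hi) =
    ∈[⋯⟩-weakenˡ (m≤m+n a (2 ^ m)) (lo , subst (toℕ u <_) (a+2^m+2^m≡a+2^[1+m] a m) hi)

  InWindow-split : ∀ m {a u} → InWindow (suc m) a u → InWindow m a u ⊎ InWindow m (a + 2 ^ m) u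
  InWindow-split m {a} {u} u∈ with ∈[⋯⟩-split (a + 2 ^ m) u∈
  ... | inj₁ lower         = inj₁ lower
  ... | inj₂ (lo , hi)     = inj₂ (lo , subst (toℕ u <_) (sym (a+2^m+2^m≡a+2^[1+m] a m)) hi)

module BoxSearch {n : ℕ} (P Q : Subset n) where

  window : ℕ → ℕ → ℕ → Subset n
  window m a b = (P ∩ interval a (a + 2 ^ m)) ∪ (Q ∩ interval b (b + 2 ^ m))

  window⁺ˡ : ∀ {m a b u} → u ∈ₛ P → InWindow m a u → u ∈ₛ window m a b
  window⁺ˡ u∈P inWindow = Subsetₚ.x∈p∪q⁺ (inj₁ (Subsetₚ.x∈p∩q⁺ (u∈P , ∈-select⁺ _ inWindow)))

  window⁺ʳ : ∀ {m a b u} → u ∈ₛ Q → InWindow m b u → u ∈ₛ window m a b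
  window⁺ʳ u∈Q inWindow = Subsetₚ.x∈p∪q⁺ (inj₂ (Subsetₚ.x∈p∩q⁺ (u∈Q , ∈-select⁺ _ inWindow)))

  window⁻ : ∀ {m a b u} → u ∈ₛ window m a b → (u ∈ₛ P × InWindow m a u) ⊎ (u ∈ₛ Q × InWindow m b u)
  window⁻ {m} {a} {b} u∈ with Subsetₚ.x∈p∪q⁻ (P ∩ interval a (a + 2 ^ m)) _ u∈
  ... | inj₁ u∈P∩ = let u∈P , u∈I = Subsetₚ.x∈p∩q⁻ P _ u∈P∩ in inj₁ (u∈P , ∈-select⁻ _ u∈I)
  ... | inj₂ u∈Q∩ = let u∈Q , u∈I = Subsetₚ.x∈p∩q⁻ Q _ u∈Q∩ in inj₂ (u∈Q , ∈-select⁻ _ u∈I)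

  ∪⊆window : ∀ {m a b} → (∀ u → InWindow m a u) → (∀ u → InWindow m b u) → P ∪ Q ⊆ window m a b
  ∪⊆window {m} coverˡ coverʳ u∈ with Subsetₚ.x∈p∪q⁻ P Q u∈
  ... | inj₁ u∈P = window⁺ˡ {m = m} u∈P (coverˡ _)
  ... | inj₂ u∈Q = window⁺ʳ {m = m} u∈Q (coverʳ _)

  -- Only called after a query has found an edge in the 1 × 1 box (a , b), so the pair is an edge.
  reportCell : ℕ → ℕ → Alg n
  reportCell a b with a <? n | b <? n
  ... | yes a<n | yes b<n = report (fromℕ< a<n) (fromℕ< b<n) done
  ... | _       | _       = done

  probe explore : ℕ → ℕ → ℕ → Alg n
  probe m a b = query (window m a b) (λ independent → if independent then done else explore m a b)
  explore zero    a b = reportCell a b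
  explore (suc m) a b = probe m a b >> probe m a (b + 2 ^ m) >> probe m (a + 2 ^ m) b >> probe m (a + 2 ^ m) (b + 2 ^ m)

  module Edges (G : Graph n) where

    CrossEdge : Fin n × Fin n → Set
    CrossEdge (u , v) = u ∈ₛ P × v ∈ₛ Q × adj G u v ≡ true

    crossEdge? : Decidable CrossEdge
    crossEdge? (u , v) = (u Subsetₚ.∈? P) ×-dec (v Subsetₚ.∈? Q) ×-dec (adj G u v Bool.≟ true)

    cellEdges : ℕ → ℕ → List (Fin n × Fin n)
    cellEdges a b with a <? n | b <? n
    ... | yes a<n | yes b<n = filter crossEdge? ((fromℕ< a<n , fromℕ< b<n) ∷ [])
    ... | _       | _       = []

    boxEdges : ℕ → ℕ → ℕ → List (Fin n × Fin n)
    boxEdges zero    a b = cellEdges a b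
    boxEdges (suc m) a b =
      boxEdges m a b ++ boxEdges m a (b + 2 ^ m) ++ boxEdges m (a + 2 ^ m) b ++ boxEdges m (a + 2 ^ m) (b + 2 ^ m)

    InBox : ℕ → ℕ → ℕ → Fin n × Fin n → Set
    InBox m a b (u , v) = InWindow m a u × InWindow m b v

    ∈-cellEdges⁻ : ∀ {a b x} → x ∈ cellEdges a b → CrossEdge x × InBox 0 a b x
    ∈-cellEdges⁻ {a} {b} x∈ with a <? n | b <? n
    ... | yes a<n | yes b<n with ∈-filter⁻ crossEdge? {xs = (fromℕ< a<n , fromℕ< b<n) ∷ []} x∈
    ...   | here refl , crossEdge = crossEdge , atCell a<n , atCell b<n
      where
      atCell : ∀ {c} (c<n : c < n) → toℕ (fromℕ< c<n) ∈[ c ⋯ c + 2 ^ 0 ⟩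
      atCell {c} c<n = subst (_∈[ c ⋯ c + 1 ⟩) (sym (toℕ-fromℕ< c<n)) (≤-refl , m<m+n c z<s)
    ∈-cellEdges⁻ {a} {b} () | yes _ | no _
    ∈-cellEdges⁻ {a} {b} () | no _  | _

    ∈-cellEdges⁺ : ∀ {a b u v} → CrossEdge (u , v) → InBox 0 a b (u , v) → (u , v) ∈ cellEdges a b
    ∈-cellEdges⁺ {a} {b} {u} {v} crossEdge (u∈ , v∈) with a <? n | b <? n
    ... | yes a<n | yes b<n = ∈-filter⁺ crossEdge? (here (cong₂ _,_ (at u∈ a<n) (at v∈ b<n))) crossEdge
      where
      at : ∀ {w c} → toℕ w ∈[ c ⋯ c + 1 ⟩ → (c<n : c < n) → w ≡ fromℕ< c<n
      at w∈ c<n = toℕ-injective (trans (∈[⋯+1⟩⇒≡ w∈) (sym (toℕ-fromℕ< c<n)))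
    ... | yes _   | no b≮n  = ⊥-elim (b≮n (subst (_< n) (∈[⋯+1⟩⇒≡ v∈) (toℕ<n v)))
    ... | no a≮n  | _       = ⊥-elim (a≮n (subst (_< n) (∈[⋯+1⟩⇒≡ u∈) (toℕ<n u)))

    ∈-boxEdges⁻ : ∀ m {a b x} → x ∈ boxEdges m a b → CrossEdge x × InBox m a b x
    ∈-boxEdges⁻ zero    x∈ = ∈-cellEdges⁻ x∈
    ∈-boxEdges⁻ (suc m) {a} {b} x∈ with ∈-++⁻ (boxEdges m a b) x∈
    ... | inj₁ x∈₀₀ = let e , u∈ , v∈ = ∈-boxEdges⁻ m x∈₀₀ in e , InWindow-lower m u∈ , InWindow-lower m v∈
    ... | inj₂ x∈′ with ∈-++⁻ (boxEdges m a (b + 2 ^ m)) x∈′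
    ...   | inj₁ x∈₀₁ = let e , u∈ , v∈ = ∈-boxEdges⁻ m x∈₀₁ in e , InWindow-lower m u∈ , InWindow-upper m v∈
    ...   | inj₂ x∈″ with ∈-++⁻ (boxEdges m (a + 2 ^ m) b) x∈″
    ...     | inj₁ x∈₁₀ = let e , u∈ , v∈ = ∈-boxEdges⁻ m x∈₁₀ in e , InWindow-upper m u∈ , InWindow-lower m v∈
    ...     | inj₂ x∈₁₁ = let e , u∈ , v∈ = ∈-boxEdges⁻ m x∈₁₁ in e , InWindow-upper m u∈ , InWindow-upper m v∈

    ∈-boxEdges⁺ : ∀ m {a b u v} → CrossEdge (u , v) → InBox m a b (u , v) → (u , v) ∈ boxEdges m a b
    ∈-boxEdges⁺ zero    e inBox = ∈-cellEdges⁺ e inBox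
    ∈-boxEdges⁺ (suc m) {a} {b} e (u∈ , v∈) with InWindow-split m u∈ | InWindow-split m v∈
    ... | inj₁ u∈₀ | inj₁ v∈₀ = ∈-++⁺ˡ (∈-boxEdges⁺ m e (u∈₀ , v∈₀))
    ... | inj₁ u∈₀ | inj₂ v∈₁ = ∈-++⁺ʳ (boxEdges m a b) (∈-++⁺ˡ (∈-boxEdges⁺ m e (u∈₀ , v∈₁)))
    ... | inj₂ u∈₁ | inj₁ v∈₀ = ∈-++⁺ʳ (boxEdges m a b) (∈-++⁺ʳ (boxEdges m a (b + 2 ^ m))
                                  (∈-++⁺ˡ (∈-boxEdges⁺ m e (u∈₁ , v∈₀))))
    ... | inj₂ u∈₁ | inj₂ v∈₁ = ∈-++⁺ʳ (boxEdges m a b) (∈-++⁺ʳ (boxEdges m a (b + 2 ^ m))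
                                  (∈-++⁺ʳ (boxEdges m (a + 2 ^ m) b) (∈-boxEdges⁺ m e (u∈₁ , v∈₁))))

    boxEdges-separated : ∀ m {a b a′ b′} → a + 2 ^ m ≤ a′ ⊎ b + 2 ^ m ≤ b′ →
                         Disjoint (boxEdges m a b) (boxEdges m a′ b′)
    boxEdges-separated m apart (x∈ , x∈′)
      with proj₂ (∈-boxEdges⁻ m x∈) | proj₂ (∈-boxEdges⁻ m x∈′) | apart
    ... | (_ , u<) , _ | (a′≤u , _) , _ | inj₁ a+2ᵐ≤a′ = <⇒≱ u< (≤-trans a+2ᵐ≤a′ a′≤u)
    ... | _ , (_ , v<) | _ , (b′≤v , _) | inj₂ b+2ᵐ≤b′ = <⇒≱ v< (≤-trans b+2ᵐ≤b′ b′≤v)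

    boxEdges-unique : ∀ m a b → Unique (boxEdges m a b)
    boxEdges-unique zero    a b with a <? n | b <? n
    ... | yes a<n | yes b<n = Uniqueₚ.filter⁺ crossEdge? {xs = (fromℕ< a<n , fromℕ< b<n) ∷ []} (All.[] ∷ [])
    ... | yes _   | no _    = []
    ... | no _    | _       = []
    boxEdges-unique (suc m) a b =
      Uniqueₚ.++⁺ (unique a b) (Uniqueₚ.++⁺ (unique a b′) (Uniqueₚ.++⁺ (unique a′ b) (unique a′ b′)
        (separated (inj₂ ≤-refl)))
        (disjoint-++⁺ʳ (separated (inj₁ ≤-refl)) (separated (inj₁ ≤-refl))))
        (disjoint-++⁺ʳ (separated (inj₂ ≤-refl))
          (disjoint-++⁺ʳ (separated (inj₁ ≤-refl)) (separated (inj₁ ≤-refl))))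
      where
      a′ b′ : ℕ
      a′ = a + 2 ^ m
      b′ = b + 2 ^ m
      unique : ∀ a b → Unique (boxEdges m a b)
      unique = boxEdges-unique m
      separated : ∀ {a b a′ b′} → a + 2 ^ m ≤ a′ ⊎ b + 2 ^ m ≤ b′ → Disjoint (boxEdges m a b) (boxEdges m a′ b′)
      separated = boxEdges-separated m

  module Probing (G : Graph n) (O : Subset n → Bool) (oracle : IsIndepOracle G O)
                 (P-independent : IsIndependent G P) (Q-independent : IsIndependent G Q) where

    open Edges G
    open Execution O

    crossEdge⇒window-dependent : ∀ m {a b u v} → CrossEdge (u , v) → InBox m a b (u , v) →
                                 ¬ IsIndependent G (window m a b)
    crossEdge⇒window-dependent m {u = u} {v} (u∈P , v∈Q , uv) (u∈ , v∈) independent =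
      not-¬ uv (independent u v (window⁺ˡ {m} u∈P u∈) (window⁺ʳ {m} v∈Q v∈))

    window-independent⇒boxEdges≡[] : ∀ m a b → IsIndependent G (window m a b) → boxEdges m a b ≡ []
    window-independent⇒boxEdges≡[] m a b independent = ∉⇒≡[] (boxEdges m a b) λ x∈ →
      let crossEdge , inBox = ∈-boxEdges⁻ m x∈ in crossEdge⇒window-dependent m crossEdge inBox independent

    boxEdges≡[]⇒no-crossEdge : ∀ m {a b u v} → boxEdges m a b ≡ [] →
                               u ∈ₛ P → v ∈ₛ Q → InBox m a b (u , v) → adj G u v ≡ false
    boxEdges≡[]⇒no-crossEdge m empty u∈P v∈Q inBox =
      ¬-not λ uv → ∉[] (subst (_ ∈_) empty (∈-boxEdges⁺ m (u∈P , v∈Q , uv) inBox))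

    boxEdges≡[]⇒window-independent : ∀ m a b → boxEdges m a b ≡ [] → IsIndependent G (window m a b)
    boxEdges≡[]⇒window-independent m a b empty u v u∈ v∈ with window⁻ {m} {a} {b} u∈ | window⁻ {m} {a} {b} v∈
    ... | inj₁ (u∈P , _)   | inj₁ (v∈P , _)   = P-independent u v u∈P v∈P
    ... | inj₂ (u∈Q , _)   | inj₂ (v∈Q , _)   = Q-independent u v u∈Q v∈Q
    ... | inj₁ (u∈P , u∈a) | inj₂ (v∈Q , v∈b) = boxEdges≡[]⇒no-crossEdge m empty u∈P v∈Q (u∈a , v∈b)
    ... | inj₂ (u∈Q , u∈b) | inj₁ (v∈P , v∈a) =
      trans (Graph.sym G u v) (boxEdges≡[]⇒no-crossEdge m empty v∈P u∈Q (v∈a , u∈b))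

    -- Costs are written m * 4 because suc m * 4 reduces to 4 + m * 4, the shape streams-absorb 4 produces.
    probe-streams   : ∀ m a b → Streams (probe m a b) (boxEdges m a b) 1 (m * 4)
    explore-streams : ∀ m a b → boxEdges m a b ≢ [] → Streams (explore m a b) (boxEdges m a b) 0 (m * 4)

    probe-streams m a b = streams-query (continue (O (window m a b)) refl)
      where
      continue : ∀ r → O (window m a b) ≡ r →
                 Streams (if r then done else explore m a b) (boxEdges m a b) 0 (m * 4)
      continue true  independent = subst (λ L → Streams done L 0 (m * 4))
        (sym (window-independent⇒boxEdges≡[] m a b (Equivalence.to (oracle _) independent))) streams-done
      continue false dependent   = explore-streams m a b λ empty →
        not-¬ (Equivalence.from (oracle _) (boxEdges≡[]⇒window-independent m a b empty)) dependent

    explore-streams zero a b nonempty with a <? n | b <? n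
    ... | yes a<n | yes b<n = subst (λ L → Streams _ L 0 0) (sym (filter-[x]≢[]⇒≡[x] crossEdge? _ nonempty))
                                (streams-report _ _ streams-done)
    explore-streams zero a b nonempty | yes _ | no _ = ⊥-elim (nonempty refl)
    explore-streams zero a b nonempty | no _  | _    = ⊥-elim (nonempty refl)
    explore-streams (suc m) a b nonempty = streams-absorb 4 nonempty
      (streams->> (probe-streams m a b) (streams->> (probe-streams m a (b + 2 ^ m))
        (streams->> (probe-streams m (a + 2 ^ m) b) (probe-streams m (a + 2 ^ m) (b + 2 ^ m)))))

-- Enumerating the edges between blocks

module Enumeration {n K : ℕ} (A : Fin (suc K) → Subset n) where

  -- Opaque, so that unification sees block i rather than a stuck with-clause and can infer i.
  opaque
    block : ℕ → Subset n
    block i with i <? suc K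
    ... | yes i<k = A (fromℕ< i<k)
    ... | no  _   = ⊥

    block-fromℕ< : ∀ {i} (i<k : i < suc K) → block i ≡ A (fromℕ< i<k)
    block-fromℕ< {i} i<k with i <? suc K
    ... | yes _   = refl
    ... | no  i≮k = ⊥-elim (i≮k i<k)

    ∈-block⁺ : ∀ i {u} → u ∈ₛ A i → u ∈ₛ block (toℕ i)
    ∈-block⁺ i {u} u∈ with toℕ i <? suc K
    ... | yes i<k = subst (λ j → u ∈ₛ A j) (sym (fromℕ<-toℕ i i<k)) u∈
    ... | no  i≮k = ⊥-elim (i≮k (toℕ<n i))

    ∈-block⁻ : ∀ i {u} → u ∈ₛ block i → Σ (Fin (suc K)) λ i′ → toℕ i′ ≡ i × u ∈ₛ A i′
    ∈-block⁻ i u∈ with i <? suc K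
    ... | yes i<k = fromℕ< i<k , toℕ-fromℕ< i<k , u∈
    ... | no  _   = ⊥-elim (Subsetₚ.∉⊥ u∈)

    block-independent : ∀ {G} → (∀ i → IsIndependent G (A i)) → ∀ i → IsIndependent G (block i)
    block-independent independent i u v u∈ v∈ with i <? suc K
    ... | yes i<k = independent (fromℕ< i<k) u v u∈ v∈
    ... | no  _   = ⊥-elim (Subsetₚ.∉⊥ u∈)

  block-disjoint : PairwiseDisjoint A → ∀ {i j u} → u ∈ₛ block i → u ∈ₛ block j → i ≡ j
  block-disjoint disjoint {i} {j} u∈i u∈j with ∈-block⁻ i u∈i | ∈-block⁻ j u∈j
  ... | i′ , refl , u∈i′ | j′ , refl , u∈j′ with i′ Fin.≟ j′
  ...   | yes refl  = refl
  ...   | no  i′≢j′ = ⊥-elim (disjoint i′ j′ i′≢j′ (_ , Subsetₚ.x∈p∩q⁺ (u∈i′ , u∈j′)))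

  depth : ℕ
  depth = ⌈log₂ n ⌉

  searchPair : ℕ → ℕ → Alg n
  searchPair i j = BoxSearch.probe (block i) (block j) depth 0 0

  searchRow : ℕ → Alg n
  searchRow i = sequenceFrom (searchPair i) (suc i) (K ∸ i)

  searchAll : Alg n
  searchAll = sequenceFrom searchRow 0 K

  row-end : ∀ {i} → i ≤ K → suc i + (K ∸ i) ≡ suc K
  row-end i≤K = cong suc (m+[n∸m]≡n i≤K)

  InWindow-root : ∀ u → InWindow depth 0 u
  InWindow-root u = z≤n , <-≤-trans (toℕ<n u) (n≤2^⌈log₂n⌉ n)

  module Edges (G : Graph n) where

    Link : ℕ → ℕ → Fin n × Fin n → Set
    Link i j = BoxSearch.Edges.CrossEdge (block i) (block j) G

    pairEdges : ℕ → ℕ → List (Fin n × Fin n)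
    pairEdges i j = BoxSearch.Edges.boxEdges (block i) (block j) G depth 0 0

    rowEdges : ℕ → List (Fin n × Fin n)
    rowEdges i = concatFrom (pairEdges i) (suc i) (K ∸ i)

    allEdges : List (Fin n × Fin n)
    allEdges = concatFrom rowEdges 0 K

    ∈-pairEdges⁻ : ∀ {i j x} → x ∈ pairEdges i j → Link i j x
    ∈-pairEdges⁻ {i} {j} x∈ = proj₁ (BoxSearch.Edges.∈-boxEdges⁻ (block i) (block j) G depth x∈)

    ∈-pairEdges⁺ : ∀ {i j x} → Link i j x → x ∈ pairEdges i j
    ∈-pairEdges⁺ {i} {j} {u , v} link =
      BoxSearch.Edges.∈-boxEdges⁺ (block i) (block j) G depth link (InWindow-root u , InWindow-root v)

    ∈-allEdges⁻ : ∀ {x} → x ∈ allEdges → Σ ℕ λ i → Σ ℕ λ j → i < j × j ≤ K × Link i j x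
    ∈-allEdges⁻ x∈ with ∈-concatFrom⁻ rowEdges 0 K x∈
    ... | i , _ , i<K , x∈row with ∈-concatFrom⁻ (pairEdges i) (suc i) (K ∸ i) x∈row
    ...   | j , i<j , j<end , x∈pair =
      i , j , i<j , ≤-pred (subst (j <_) (row-end (<⇒≤ i<K)) j<end) , ∈-pairEdges⁻ x∈pair

    ∈-allEdges⁺ : ∀ {i j x} → i < j → j ≤ K → Link i j x → x ∈ allEdges
    ∈-allEdges⁺ {i} {j} i<j j≤K link =
      ∈-concatFrom⁺ rowEdges 0 K z≤n (<-≤-trans i<j j≤K)
        (∈-concatFrom⁺ (pairEdges i) (suc i) (K ∸ i) i<j
          (subst (j <_) (sym (row-end (<⇒≤ (<-≤-trans i<j j≤K)))) (s≤s j≤K)) (∈-pairEdges⁺ link))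

    module _ (disjoint : PairwiseDisjoint A) where

      allEdges-unique : Unique allEdges
      allEdges-unique = concatFrom-unique rowEdges 0 K row-unique same-row
        where
        row-unique : ∀ i → Unique (rowEdges i)
        row-unique i = concatFrom-unique (pairEdges i) (suc i) (K ∸ i)
          (λ j → BoxSearch.Edges.boxEdges-unique (block i) (block j) G depth 0 0)
          (λ x∈j x∈j′ → block-disjoint disjoint (proj₁ (proj₂ (∈-pairEdges⁻ x∈j)))
                                                (proj₁ (proj₂ (∈-pairEdges⁻ x∈j′))))
        same-row : ∀ {i i′ x} → x ∈ rowEdges i → x ∈ rowEdges i′ → i ≡ i′
        same-row {i} {i′} x∈i x∈i′
          with ∈-concatFrom⁻ (pairEdges i) (suc i) (K ∸ i) x∈i | ∈-concatFrom⁻ (pairEdges i′) (suc i′) (K ∸ i′) x∈i′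
        ... | _ , _ , _ , x∈ij | _ , _ , _ , x∈i′j′ =
          block-disjoint disjoint (proj₁ (∈-pairEdges⁻ x∈ij)) (proj₁ (∈-pairEdges⁻ x∈i′j′))

      allEdges-unswapped : ∀ {u v} → (u , v) ∈ allEdges → ¬ (v , u) ∈ allEdges
      allEdges-unswapped uv∈ vu∈ with ∈-allEdges⁻ uv∈ | ∈-allEdges⁻ vu∈
      ... | i , j , i<j , _ , u∈i , v∈j , _ | i′ , j′ , i′<j′ , _ , v∈i′ , u∈j′ , _
        = <-asym i<j (subst₂ _<_ (block-disjoint disjoint v∈i′ v∈j) (block-disjoint disjoint u∈j′ u∈i) i′<j′)

      allEdges-distinct : AllPairs (λ x y → ¬ SamePair x y) allEdges
      allEdges-distinct = unique⇒AllPairs¬ allEdges-unique collapse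
        where
        collapse : ∀ {x y} → x ∈ allEdges → y ∈ allEdges → SamePair x y → x ≡ y
        collapse _   _   (inj₁ (refl , refl)) = refl
        collapse x∈ y∈ (inj₂ (refl , refl)) = ⊥-elim (allEdges-unswapped x∈ y∈)

    allEdges-induced : ∀ {x} → x ∈ allEdges → InducedEdge G (bigUnion A) (proj₁ x) (proj₂ x)
    allEdges-induced x∈ with ∈-allEdges⁻ x∈
    ... | i , j , _ , _ , u∈i , v∈j , uv with ∈-block⁻ i u∈i | ∈-block⁻ j v∈j
    ...   | i′ , _ , u∈i′ | j′ , _ , v∈j′ = ∈-bigUnion⁺ A i′ u∈i′ , ∈-bigUnion⁺ A j′ v∈j′ , uv

    allEdges-complete : (∀ i → IsIndependent G (A i)) →
                        ∀ {u v} → InducedEdge G (bigUnion A) u v → (u , v) ∈ allEdges ⊎ (v , u) ∈ allEdges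
    allEdges-complete independent {u} {v} (u∈ , v∈ , uv) with ∈-bigUnion⁻ A u∈ | ∈-bigUnion⁻ A v∈
    ... | i , u∈i | j , v∈j with <-cmp (toℕ i) (toℕ j)
    ...   | tri< i<j _ _ =
      inj₁ (∈-allEdges⁺ i<j (≤-pred (toℕ<n j)) (∈-block⁺ i u∈i , ∈-block⁺ j v∈j , uv))
    ...   | tri> _ _ j<i =
      inj₂ (∈-allEdges⁺ j<i (≤-pred (toℕ<n i)) (∈-block⁺ j v∈j , ∈-block⁺ i u∈i , trans (Graph.sym G v u) uv))
    ...   | tri≈ _ i≡j _ =
      ⊥-elim (not-¬ uv (independent i u v u∈i (subst (λ l → v ∈ₛ A l) (sym (toℕ-injective i≡j)) v∈j)))

  module Correctness (2≤K : 2 ≤ K) (G : Graph n) (O : Subset n → Bool) (oracle : IsIndepOracle G O)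
                     (disjoint : PairwiseDisjoint A) (independent : ∀ i → IsIndependent G (A i))
                     (dependent : ∀ i j → toℕ i < toℕ j → suc (toℕ j) < suc K → ¬ IsIndependent G (A i ∪ A j))
                     where

    open Edges G
    open Execution O

    pair-streams : ∀ i j → Streams (searchPair i j) (pairEdges i j) 1 (depth * 4)
    pair-streams i j = BoxSearch.Probing.probe-streams (block i) (block j) G O oracle
      (block-independent {G} independent i) (block-independent {G} independent j) depth 0 0

    pair-nonempty : ∀ {i j} → i < j → j < K → pairEdges i j ≢ []
    pair-nonempty {i} {j} i<j j<K empty =
      dependent (fromℕ< i<k) (fromℕ< j<k)
        (subst₂ _<_ (sym (toℕ-fromℕ< i<k)) (sym (toℕ-fromℕ< j<k)) i<j)
        (subst (λ l → suc l < suc K) (sym (toℕ-fromℕ< j<k)) (s≤s j<K))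
        (subst₂ (λ U W → IsIndependent G (U ∪ W)) (block-fromℕ< i<k) (block-fromℕ< j<k)
          (IsIndependent-⊆ G (BoxSearch.∪⊆window (block i) (block j) {depth} {0} {0} InWindow-root InWindow-root)
            (BoxSearch.Probing.boxEdges≡[]⇒window-independent (block i) (block j) G O oracle
              (block-independent {G} independent i) (block-independent {G} independent j) depth 0 0 empty)))
      where
      j<k : j < suc K
      j<k = <-trans j<K (n<1+n K)
      i<k : i < suc K
      i<k = <-trans i<j j<k

    row-streams : ∀ i → i < K → Streams (searchRow i) (rowEdges i) 1 (1 + depth * 4)
    row-streams i i<K = streams-sequenceFrom (suc i) (K ∸ i) (λ j _ _ → pair-streams i j)
      (λ j i<j 1+j<end → pair-nonempty i<j (≤-pred (subst (suc j <_) (row-end (<⇒≤ i<K)) 1+j<end)))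

    row-nonempty : ∀ {i} → suc i < K → rowEdges i ≢ []
    row-nonempty {i} 1+i<K = concatFrom-≢[] (pairEdges i) (suc i) (K ∸ i) ≤-refl
      (m<m+n (suc i) (m<n⇒0<n∸m (<-trans (n<1+n i) 1+i<K))) (pair-nonempty (n<1+n i) 1+i<K)

    allEdges-nonempty : allEdges ≢ []
    allEdges-nonempty = concatFrom-≢[] rowEdges 0 K z≤n (<-trans z<s 2≤K) (row-nonempty 2≤K)

    searchAll-streams : Streams searchAll allEdges 0 (3 + depth * 4)
    searchAll-streams = streams-absorb 1 allEdges-nonempty
      (streams-sequenceFrom 0 K (λ i _ i<K → row-streams i i<K) (λ i _ 1+i<K → row-nonempty 1+i<K))

    depth-positive : 1 ≤ depth
    depth-positive =
      let x , x∈ = ≢[]⇒∈ allEdges-nonempty in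
      ⌈log₂⌉-mono-≤ (≢⇒2≤n (InducedEdge⇒≢ {G = G} (allEdges-induced x∈)))

    enumeration : Enumerates G (bigUnion A) (output 0 searchAll)
    enumeration = enumerates G (bigUnion A) (output 0 searchAll) allEdges (Streams.reports searchAll-streams 0)
      allEdges-induced (allEdges-complete independent) (allEdges-distinct disjoint)

    report-times : ∀ t → timeOf (lookup (output 0 searchAll) t) ≤ 7 * (suc (toℕ t) * depth)
    report-times t = ≤-trans (OnSchedule-lookup (output 0 searchAll) (Streams.onSchedule searchAll-streams 0) t)
      (m*[3+d*4]≤7*[m*d] depth-positive (suc (toℕ t)))

    total-queries : endTime 0 searchAll ≤ 7 * (edgeCount G (bigUnion A) * depth)
    total-queries = begin
      endTime 0 searchAll                           ≤⟨ Streams.haltsBy searchAll-streams 0 ⟩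
      length allEdges * (3 + depth * 4)             ≤⟨ *-monoˡ-≤ (3 + depth * 4) edges≤edgeCount ⟩
      edgeCount G (bigUnion A) * (3 + depth * 4)    ≤⟨ m*[3+d*4]≤7*[m*d] depth-positive (edgeCount G (bigUnion A)) ⟩
      7 * (edgeCount G (bigUnion A) * depth)        ∎
      where
      open ≤-Reasoning
      edges≤edgeCount : length allEdges ≤ edgeCount G (bigUnion A)
      edges≤edgeCount = length≤edgeCount G (bigUnion A) allEdges allEdges-induced (allEdges-distinct disjoint)

lemmaA4 : Σ ℕ λ C →
    ∀ n k (A : Fin k → Subset n) → 3 ≤ k →
    Σ (Alg n) λ alg →
      ∀ (G : Graph n) (O : Subset n → Bool) → IsIndepOracle G O →
      PairwiseDisjoint A →
      (∀ i → IsIndependent G (A i)) →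
      (∀ i j → toℕ i < toℕ j → suc (toℕ j) < k → ¬ IsIndependent G (A i ∪ A j)) →
      Enumerates G (bigUnion A) (proj₁ (run alg O))
      × (∀ t → timeOf (lookup (proj₁ (run alg O)) t) ≤ C * (suc (toℕ t) * ⌈log₂ n ⌉))
      × proj₂ (run alg O) ≤ C * (edgeCount G (bigUnion A) * ⌈log₂ n ⌉)
lemmaA4 = 7 , λ where
  n (suc K) A (s≤s 2≤K) → Enumeration.searchAll A , λ G O oracle disjoint independent dependent →
    let open Enumeration.Correctness A 2≤K G O oracle disjoint independent dependent
    in enumeration , report-times , total-queries
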